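{- Let $k,l\geq 1$ be integers and let $(M,d)$ be a uniform metric space. The Hitting Set algorithm (HS) for $(k,l)$-MSSMS on $(M,d)$ is $k\cdot\left({{k+l}\choose{l}}-1\right)$-competitive.
   Context: The $(k,l)$-MSSMS problem on a metric space $(M,d)$: there are $k$ servers, initially located at points of $M$ (an initial configuration $X_0$, a multiset of $k$ points of $M$). Requests $R_1,R_2,\ldots$ arrive one at a time, each a set $R_i\subseteq M$ with $|R_i|=l$. After $R_i$ is revealed, the algorithm may move servers, and the resulting configuration $X_i$ (multiset of $k$ points) must contain at least one point of $R_i$. The cost is the total distance traveled by the servers. $\mathrm{OPT}(\rho)$ denotes the minimum possible cost of serving the request sequence $\rho$ from $X_0$. An online algorithm chooses $X_i$ knowing only $X_0,R_1,\ldots,R_i$. A deterministic online algorithm is $c$-competitive if there is a constant $\alpha$ such that for every finite request sequence $\rho$ its cost on $\rho$ is at most $c\cdot\mathrm{OPT}(\rho)+\alpha$. A uniform metric space is one with $d(x,y)=1$ for all distinct $x,y$. The Hitting Set algorithm (HS): the request sequence is divided into phases, the first phase starting with the first request. A request produces a fault if it is disjoint from the set of points currently occupied by the servers. On a request that does not produce a fault, HS does nothing. Each time a request produces a fault, HS computes a minimum cardinality set $H\subseteq M$ that intersects every request that produced a fault during the current phase (including the current one). If $|H|\leq k$, then some $|H|$ of the servers (any choice) are moved so as to occupy all points of $H$. If $|H|>k$, the current phase terminates and a new phase begins with the current request (which is then treated as the first faulting request of the new phase). Ties in choosing $H$ and the servers are broken arbitrarily. -}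

module Defs where

open import Data.Nat using (ℕ; zero; suc; _+_; _*_; _∸_; _≤_; _<_)
open import Data.Fin using (Fin)
open import Data.Vec using (Vec; toList; lookup; zipWith)
open import Data.List using (List; []; _∷_; _∷ʳ_; length; map; sum)
open import Data.List.Membership.Propositional using (_∈_; _∉_)
open import Data.List.Relation.Unary.Any using (Any)
open import Data.List.Relation.Unary.All using (All)
open import Data.List.Relation.Unary.Unique.Propositional using (Unique)
open import Data.List.Relation.Binary.Pointwise using (Pointwise)
open import Data.Product using (Σ; ∃; _×_; _,_; proj₁; proj₂)
open import Data.Sum using (_⊎_)
open import Relation.Nullary using (¬_)
open import Relation.Binary.PropositionalEquality using (_≡_; _≢_)

record UniformMetricSpace : Set₁ where
  field
    Carrier   : Set
    d         : Carrier → Carrier → ℕ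
    d-refl    : ∀ x → d x x ≡ 0
    d-uniform : ∀ x y → x ≢ y → d x y ≡ 1

module MSSMS (𝕄 : UniformMetricSpace) (k l : ℕ) where
  open UniformMetricSpace 𝕄 renaming (Carrier to M)

  record Request : Set where
    constructor request
    field
      pts    : List M
      unique : Unique pts
      size   : length pts ≡ l
  open Request public

  Config : Set
  Config = Vec M k

  Intersects : List M → List M → Set
  Intersects xs ys = Any (λ x → x ∈ ys) xs

  Serves : Config → Request → Set
  Serves C R = Intersects (pts R) (toList C)

  moveCost : Config → Config → ℕ
  moveCost C C' = Data.Vec.foldr (λ _ → ℕ) _+_ 0 (zipWith d C C')
    where import Data.Vec

  pathCost : Config → List Config → ℕ
  pathCost X []       = 0
  pathCost X (Y ∷ Ys) = moveCost X Y + pathCost Y Ys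

  Feasible : List Request → List Config → Set
  Feasible ρ Ys = Pointwise (λ R Y → Serves Y R) ρ Ys

  HittingSet : List Request → List M → Set
  HittingSet F H = Unique H × All (λ R → Intersects (pts R) H) F

  MinHittingSet : List Request → List M → Set
  MinHittingSet F H =
    HittingSet F H × (∀ H' → HittingSet F H' → length H ≤ length H')

  -- C' arises from C by moving some |H| servers (the list S, distinct)
  -- onto the points of H (bijectively), all other servers staying put.
  MovesOnto : Config → List M → Config → Set
  MovesOnto C H C' =
    Σ (List (Fin k)) λ S →
      Unique S × map (lookup C') S ≡ H × (∀ i → i ∉ S → lookup C' i ≡ lookup C i)

  -- State of HS: current configuration and the list of requests that
  -- produced a fault during the current phase.
  HSState : Set
  HSState = Config × List Request

  data HSStep : HSState → Request → HSState → Set where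
    no-fault : ∀ {C F R} → Serves C R → HSStep (C , F) R (C , F)
    fault-same-phase : ∀ {C F R C' H} → ¬ Serves C R →
      MinHittingSet (R ∷ F) H → length H ≤ k → MovesOnto C H C' →
      HSStep (C , F) R (C' , R ∷ F)
    fault-new-phase : ∀ {C F R C' H H₁} → ¬ Serves C R →
      MinHittingSet (R ∷ F) H → k < length H →
      MinHittingSet (R ∷ []) H₁ → MovesOnto C H₁ C' →
      HSStep (C , F) R (C' , R ∷ [])

  -- A deterministic online algorithm: maps the history of requests seen so
  -- far (oldest first) to its state after serving them.
  record IsHS (X₀ : Config) (A : List Request → HSState) : Set where
    field
      start : A [] ≡ (X₀ , [])
      step  : ∀ h R → HSStep (A h) R (A (h ∷ʳ R))

  runConfigs : (List Request → HSState) → List Request → List Request → List Config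
  runConfigs A acc []      = []
  runConfigs A acc (R ∷ ρ) = proj₁ (A (acc ∷ʳ R)) ∷ runConfigs A (acc ∷ʳ R) ρ

  algCost : (List Request → HSState) → Config → List Request → ℕ
  algCost A X₀ ρ = pathCost X₀ (runConfigs A [] ρ)

module Submission where

-- Fix a phase and let R₁, R₂, … be its faulting requests, Hᵢ the hitting set the servers
-- occupy when Rᵢ arrives. Then |Rᵢ| = l, |Hᵢ| ≤ k, Rᵢ ∩ Hᵢ = ∅ (it is a fault) and Rⱼ ∩ Hᵢ ≠ ∅
-- for j < i (Hᵢ hits the earlier faults), so by the skew Bollobás theorem a phase has at most
-- c = C(k+l, l) faults, each costing HS at most k.  A phase ends only when its faults have no
-- hitting set of size ≤ k, so the offline servers cannot sit on one throughout: the adversary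
-- pays at least 1 per phase.  Both facts are combined by the potential
--   Φ = k · (c − #faults so far in the phase) + k(c − 1) · [the offline servers miss one of them].
-- The Bollobás bound is proved by the polynomial method: labelling points by integers, Rᵢ gives
-- the degree-l form ∏_{a ∈ Rᵢ} (y₀ + a y₁ + ⋯ + aᵏ yₖ) and Hⱼ the coefficient vector of
-- ∏_{b ∈ Hⱼ} (z − b); evaluation yields ∏∏ (a − b), a triangular matrix with nonzero diagonal
-- in the C(k+l, l)-dimensional space of such forms.

open import Defs

module LinearAlgebra where

  open import Data.Nat as ℕ using (zero; suc; z≤n; s≤s)
  open import Data.Integer using (ℤ; 0ℤ; _+_; _-_; _*_; _≟_)
  open import Data.Integer.Properties using (+-identityˡ; *-zeroˡ; *-zeroʳ; i*j≡0⇒i≡0∨j≡0)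
  open import Data.Integer.Tactic.RingSolver using (solve-∀)
  open import Data.Fin using (Fin)
  open import Data.Vec using (Vec; []; _∷_; lookup; zipWith; removeAt)
  open import Data.Vec.Properties using (lookup-zipWith)
  open import Data.List using (List; []; _∷_; length; map)
  open import Data.List.Properties using (length-map)
  open import Data.List.Relation.Unary.All as All using (All; []; _∷_)
  open import Data.List.Relation.Unary.All.Properties using (map⁺)
  open import Data.Product using (∃; _×_; _,_; proj₁; proj₂)
  open import Data.Sum using ([_,_])
  open import Relation.Nullary using (yes; no; contradiction)
  open import Relation.Binary.PropositionalEquality hiding ([_])

  i≢0∧j≢0⇒i*j≢0 : ∀ {i j} → i ≢ 0ℤ → j ≢ 0ℤ → i * j ≢ 0ℤ
  i≢0∧j≢0⇒i*j≢0 {i} i≢0 j≢0 ij≡0 = [ i≢0 , j≢0 ] (i*j≡0⇒i≡0∨j≡0 i ij≡0)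

  dot : ∀ {n} → Vec ℤ n → Vec ℤ n → ℤ
  dot []       []       = 0ℤ
  dot (x ∷ xs) (y ∷ ys) = x * y + dot xs ys

  linComb : ∀ {n} → ℤ → ℤ → Vec ℤ n → Vec ℤ n → Vec ℤ n
  linComb a b = zipWith (λ x y → a * x - b * y)

  dot-linComb : ∀ {n} a b (u w v : Vec ℤ n) → dot (linComb a b u w) v ≡ a * dot u v - b * dot w v
  dot-linComb a b []      []      []      = zero-combination a b
    where
    zero-combination : ∀ a b → 0ℤ ≡ a * 0ℤ - b * 0ℤ
    zero-combination = solve-∀
  dot-linComb a b (x ∷ u) (y ∷ w) (z ∷ v) =
    trans (cong ((a * x - b * y) * z +_) (dot-linComb a b u w v)) (distrib a b x y z (dot u v) (dot w v))
    where
    distrib : ∀ a b x y z U W → (a * x - b * y) * z + (a * U - b * W) ≡ a * (x * z + U) - b * (y * z + W)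
    distrib = solve-∀

  dot-removeAt : ∀ {n} (u v : Vec ℤ (suc n)) i →
    dot u v ≡ lookup u i * lookup v i + dot (removeAt u i) (removeAt v i)
  dot-removeAt (x ∷ u)      (y ∷ v)      Fin.zero    = refl
  dot-removeAt (x ∷ x′ ∷ u) (y ∷ y′ ∷ v) (Fin.suc i) =
    trans (cong (x * y +_) (dot-removeAt (x′ ∷ u) (y′ ∷ v) i))
          (exchange (x * y) (lookup (x′ ∷ u) i * lookup (y′ ∷ v) i) (dot (removeAt (x′ ∷ u) i) (removeAt (y′ ∷ v) i)))
    where
    exchange : ∀ a b c → a + (b + c) ≡ b + (a + c)
    exchange = solve-∀

  dot-removeAt-zero : ∀ {n} (u v : Vec ℤ (suc n)) i → lookup u i ≡ 0ℤ →
    dot (removeAt u i) (removeAt v i) ≡ dot u v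
  dot-removeAt-zero u v i uᵢ≡0 = sym (begin
    dot u v                      ≡⟨ dot-removeAt u v i ⟩
    lookup u i * lookup v i + D  ≡⟨ cong (λ x → x * lookup v i + D) uᵢ≡0 ⟩
    0ℤ * lookup v i + D          ≡⟨ cong (_+ D) (*-zeroˡ (lookup v i)) ⟩
    0ℤ + D                       ≡⟨ +-identityˡ D ⟩
    D                            ∎)
    where
    open ≡-Reasoning
    D : ℤ
    D = dot (removeAt u i) (removeAt v i)

  dot≢0⇒nonzero-coordinate : ∀ {n} (u v : Vec ℤ n) → dot u v ≢ 0ℤ → ∃ λ i → lookup u i ≢ 0ℤ
  dot≢0⇒nonzero-coordinate []      []      dot≢0 = contradiction refl dot≢0
  dot≢0⇒nonzero-coordinate (x ∷ u) (y ∷ v) dot≢0 with x ≟ 0ℤ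
  ... | no  x≢0 = Fin.zero , x≢0
  ... | yes refl with dot≢0⇒nonzero-coordinate u v (λ uv≡0 → dot≢0 (cong (0ℤ * y +_) uv≡0))
  ...   | i , uᵢ≢0 = Fin.suc i , uᵢ≢0

  OrthogonalTo : ∀ {n} → Vec ℤ n → Vec ℤ n × Vec ℤ n → Set
  OrthogonalTo u (_ , v) = dot u v ≡ 0ℤ

  data Triangular {n} : List (Vec ℤ n × Vec ℤ n) → Set where
    []   : Triangular []
    cons : ∀ {u v ps} → dot u v ≢ 0ℤ → All (OrthogonalTo u) ps → Triangular ps →
           Triangular ((u , v) ∷ ps)

  module Elimination {n} (u : Vec ℤ (suc n)) (j : Fin (suc n)) where

    eliminate : Vec ℤ (suc n) × Vec ℤ (suc n) → Vec ℤ n × Vec ℤ n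
    eliminate (u′ , v′) = removeAt (linComb (lookup u j) (lookup u′ j) u′ u) j , removeAt v′ j

    dot-eliminate : ∀ q r → OrthogonalTo u r →
      dot (proj₁ (eliminate q)) (proj₂ (eliminate r)) ≡ lookup u j * dot (proj₁ q) (proj₂ r)
    dot-eliminate (u′ , _) (_ , v′) u⊥v′ = begin
      dot (removeAt w j) (removeAt v′ j)      ≡⟨ dot-removeAt-zero w v′ j wⱼ≡0 ⟩
      dot w v′                                ≡⟨ dot-linComb c (lookup u′ j) u′ u v′ ⟩
      c * dot u′ v′ - lookup u′ j * dot u v′  ≡⟨ cong (λ x → c * dot u′ v′ - lookup u′ j * x) u⊥v′ ⟩
      c * dot u′ v′ - lookup u′ j * 0ℤ        ≡⟨ drop-zero c (lookup u′ j) (dot u′ v′) ⟩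
      c * dot u′ v′                           ∎
      where
      open ≡-Reasoning
      c : ℤ
      c = lookup u j
      w : Vec ℤ (suc n)
      w = linComb c (lookup u′ j) u′ u
      cancel : ∀ a b → a * b - b * a ≡ 0ℤ
      cancel = solve-∀
      drop-zero : ∀ a b x → a * x - b * 0ℤ ≡ a * x
      drop-zero = solve-∀
      wⱼ≡0 : lookup w j ≡ 0ℤ
      wⱼ≡0 = trans (lookup-zipWith _ j u′ u) (cancel c (lookup u′ j))

    eliminate-triangular : lookup u j ≢ 0ℤ → ∀ ps → All (OrthogonalTo u) ps → Triangular ps →
      Triangular (map eliminate ps)
    eliminate-triangular uⱼ≢0 []       []           []                    = []
    eliminate-triangular uⱼ≢0 (q ∷ ps) (u⊥q ∷ u⊥ps) (cons diag after tri) =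
      cons diagonal
           (map⁺ {P = OrthogonalTo (proj₁ (eliminate q))} (All.zipWith (λ {r} → later {r}) (after , u⊥ps)))
           (eliminate-triangular uⱼ≢0 ps u⊥ps tri)
      where
      diagonal : dot (proj₁ (eliminate q)) (proj₂ (eliminate q)) ≢ 0ℤ
      diagonal rewrite dot-eliminate q q u⊥q = i≢0∧j≢0⇒i*j≢0 uⱼ≢0 diag
      later : ∀ {r} → OrthogonalTo (proj₁ q) r × OrthogonalTo u r → OrthogonalTo (proj₁ (eliminate q)) (eliminate r)
      later {r} (q⊥r , u⊥r) rewrite dot-eliminate q r u⊥r | q⊥r = *-zeroʳ (lookup u j)

  -- Pivoting on a coordinate where the first u is nonzero removes one pair and one dimension.
  triangular-length≤dim : ∀ {n} (ps : List (Vec ℤ n × Vec ℤ n)) → Triangular ps → length ps ℕ.≤ n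
  triangular-length≤dim         []              []                   = z≤n
  triangular-length≤dim {zero}  (([] , []) ∷ _) (cons diag _ _)      = contradiction refl diag
  triangular-length≤dim {suc n} ((u , v) ∷ ps)  (cons diag u⊥ps tri)
    with j , uⱼ≢0 ← dot≢0⇒nonzero-coordinate u v diag =
    s≤s (subst (ℕ._≤ n) (length-map eliminate ps)
               (triangular-length≤dim (map eliminate ps) (eliminate-triangular uⱼ≢0 ps u⊥ps tri)))
    where open Elimination u j

module HomogeneousPolynomials where

  open import Data.Nat as ℕ using (ℕ; zero; suc)
  import Data.Nat.Properties as ℕₚ
  open import Data.Nat.Combinatorics using (_C_; nCn≡1; nCk+nC[k+1]≡[n+1]C[k+1])
  open import Data.Integer using (ℤ; 0ℤ; 1ℤ; _+_; _*_)
  open import Data.Integer.Properties using (+-identityˡ; +-identityʳ; *-identityˡ; *-identityʳ; *-zeroʳ; *-comm; +-assoc)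
  open import Data.Integer.Tactic.RingSolver using (solve-∀)
  open import Data.Vec as Vec using (Vec; []; _∷_; _++_)
  open import Data.List using (List; []; _∷_; length; foldr; map)
  open import Data.Unit using (⊤; tt)
  open import Data.Product using (_×_; _,_)
  open import Relation.Binary.PropositionalEquality
  open LinearAlgebra

  -- Homogeneous polynomials of degree l in the variables y₀, …, y_{v-1}: a polynomial
  -- of positive degree in v + 1 variables is y₀ · p₁ + p₂ with p₂ free of y₀.
  Hom : ℕ → ℕ → Set
  Hom v       zero    = ℤ
  Hom zero    (suc l) = ⊤
  Hom (suc v) (suc l) = Hom (suc v) l × Hom v (suc l)

  eval : ∀ {v l} → Hom v l → Vec ℤ v → ℤ
  eval {l = zero}        c         _        = c
  eval {zero}  {suc l}   _         []       = 0ℤ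
  eval {suc v} {suc l}   (p₁ , p₂) (y ∷ ys) = y * eval p₁ (y ∷ ys) + eval p₂ ys

  0ₕ : ∀ {v l} → Hom v l
  0ₕ {l = zero}        = 0ℤ
  0ₕ {zero}  {suc l}   = tt
  0ₕ {suc v} {suc l}   = 0ₕ , 0ₕ

  _+ₕ_ : ∀ {v l} → Hom v l → Hom v l → Hom v l
  _+ₕ_ {l = zero}      a         b         = a + b
  _+ₕ_ {zero}  {suc l} _         _         = tt
  _+ₕ_ {suc v} {suc l} (a₁ , a₂) (b₁ , b₂) = a₁ +ₕ b₁ , a₂ +ₕ b₂

  _·ₕ_ : ∀ {v l} → ℤ → Hom v l → Hom v l
  _·ₕ_ {l = zero}      c a         = c * a
  _·ₕ_ {zero}  {suc l} c _         = tt
  _·ₕ_ {suc v} {suc l} c (a₁ , a₂) = c ·ₕ a₁ , c ·ₕ a₂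

  eval-0ₕ : ∀ {v l} (y : Vec ℤ v) → eval (0ₕ {v} {l}) y ≡ 0ℤ
  eval-0ₕ {l = zero}      _        = refl
  eval-0ₕ {zero}  {suc l} []       = refl
  eval-0ₕ {suc v} {suc l} (y ∷ ys)
    rewrite eval-0ₕ {suc v} {l} (y ∷ ys) | eval-0ₕ {v} {suc l} ys = absorb y
    where
    absorb : ∀ y → y * 0ℤ + 0ℤ ≡ 0ℤ
    absorb = solve-∀

  eval-+ₕ : ∀ {v l} (a b : Hom v l) y → eval (a +ₕ b) y ≡ eval a y + eval b y
  eval-+ₕ {l = zero}      _         _         _        = refl
  eval-+ₕ {zero}  {suc l} _         _         []       = refl
  eval-+ₕ {suc v} {suc l} (a₁ , a₂) (b₁ , b₂) (y ∷ ys)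
    rewrite eval-+ₕ a₁ b₁ (y ∷ ys) | eval-+ₕ a₂ b₂ ys = interchange y _ _ _ _
    where
    interchange : ∀ y A₁ B₁ A₂ B₂ → y * (A₁ + B₁) + (A₂ + B₂) ≡ (y * A₁ + A₂) + (y * B₁ + B₂)
    interchange = solve-∀

  eval-·ₕ : ∀ {v l} c (a : Hom v l) y → eval (c ·ₕ a) y ≡ c * eval a y
  eval-·ₕ {l = zero}      _ _         _        = refl
  eval-·ₕ {zero}  {suc l} c _         []       = sym (*-zeroʳ c)
  eval-·ₕ {suc v} {suc l} c (a₁ , a₂) (y ∷ ys)
    rewrite eval-·ₕ c a₁ (y ∷ ys) | eval-·ₕ c a₂ ys = factor c y _ _
    where
    factor : ∀ c y A₁ A₂ → y * (c * A₁) + c * A₂ ≡ c * (y * A₁ + A₂)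
    factor = solve-∀

  horner : ∀ {v} → Vec ℤ v → ℤ → ℤ
  horner []       a = 0ℤ
  horner (y ∷ ys) a = y + a * horner ys a

  powerForm : ∀ v → ℤ → Hom v 1
  powerForm zero    a = tt
  powerForm (suc v) a = 1ℤ , a ·ₕ powerForm v a

  eval-powerForm : ∀ v a (y : Vec ℤ v) → eval (powerForm v a) y ≡ horner y a
  eval-powerForm zero    a []       = refl
  eval-powerForm (suc v) a (y ∷ ys)
    rewrite eval-·ₕ a (powerForm v a) ys | eval-powerForm v a ys = cong (_+ a * horner ys a) (*-identityʳ y)

  infixl 7 _*ₕ_
  _*ₕ_ : ∀ {v l} → Hom v l → Hom v 1 → Hom v (suc l)
  _*ₕ_ {zero}          _         _        = tt
  _*ₕ_ {suc v} {zero}  c         L        = c ·ₕ L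
  _*ₕ_ {suc v} {suc l} (p₁ , p₂) (a , L) = (p₁ *ₕ (a , L)) +ₕ (0ₕ , a ·ₕ p₂) , p₂ *ₕ L

  eval-*ₕ : ∀ {v l} (p : Hom v l) (L : Hom v 1) y → eval (p *ₕ L) y ≡ eval p y * eval L y
  eval-*ₕ {zero}  {zero}  c _ []  = sym (*-zeroʳ c)
  eval-*ₕ {zero}  {suc l} _ _ []  = refl
  eval-*ₕ {suc v} {zero}  c L y   = eval-·ₕ c L y
  eval-*ₕ {suc v} {suc l} (p₁ , p₂) (a , L) (y ∷ ys)
    rewrite eval-+ₕ (p₁ *ₕ (a , L)) (0ₕ , a ·ₕ p₂) (y ∷ ys)
          | eval-*ₕ p₁ (a , L) (y ∷ ys)
          | eval-0ₕ {suc v} {l} (y ∷ ys)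
          | eval-·ₕ a p₂ ys
          | eval-*ₕ p₂ L ys
    = expand y a _ _ _
    where
    expand : ∀ y a P₁ P₂ L → y * (P₁ * (y * a + L) + (y * 0ℤ + a * P₂)) + P₂ * L ≡ (y * P₁ + P₂) * (y * a + L)
    expand = solve-∀

  ∏ : List ℤ → ℤ
  ∏ = foldr _*_ 1ℤ

  productForm : ∀ v {l} (as : List ℤ) → length as ≡ l → Hom v l
  productForm v []       refl = 1ℤ
  productForm v (a ∷ as) refl = productForm v as refl *ₕ powerForm v a

  eval-productForm : ∀ v {l} as (eq : length as ≡ l) y → eval (productForm v as eq) y ≡ ∏ (map (horner y) as)
  eval-productForm v []       refl y = refl
  eval-productForm v (a ∷ as) refl y
    rewrite eval-*ₕ (productForm v as refl) (powerForm v a) y | eval-productForm v as refl y | eval-powerForm v a y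
    = *-comm _ (horner y a)

  dim : ℕ → ℕ → ℕ
  dim v       zero    = 1
  dim zero    (suc l) = 0
  dim (suc v) (suc l) = dim (suc v) l ℕ.+ dim v (suc l)

  dim≡C : ∀ v l → dim (suc v) l ≡ (v ℕ.+ l) C l
  dim≡C v       zero    = refl
  dim≡C zero    (suc l) = trans (ℕₚ.+-identityʳ (dim 1 l)) (trans (dim≡C zero l) (trans (nCn≡1 l) (sym (nCn≡1 (suc l)))))
  dim≡C (suc v) (suc l) rewrite dim≡C (suc v) l | dim≡C v (suc l) | ℕₚ.+-suc v l =
    nCk+nC[k+1]≡[n+1]C[k+1] (suc (v ℕ.+ l)) l

  coefficients : ∀ {v l} → Hom v l → Vec ℤ (dim v l)
  coefficients {l = zero}      c         = c ∷ []
  coefficients {zero}  {suc l} _         = []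
  coefficients {suc v} {suc l} (p₁ , p₂) = coefficients p₁ ++ coefficients p₂

  monomials : ∀ {v} l → Vec ℤ v → Vec ℤ (dim v l)
  monomials         zero    _        = 1ℤ ∷ []
  monomials {zero}  (suc l) []       = []
  monomials {suc v} (suc l) (y ∷ ys) = Vec.map (y *_) (monomials l (y ∷ ys)) ++ monomials (suc l) ys

  dot-++ : ∀ {m n} (a b : Vec ℤ m) (c d : Vec ℤ n) → dot (a ++ c) (b ++ d) ≡ dot a b + dot c d
  dot-++ []      []      c d = sym (+-identityˡ (dot c d))
  dot-++ (x ∷ a) (y ∷ b) c d rewrite dot-++ a b c d = sym (+-assoc (x * y) (dot a b) (dot c d))

  dot-map-*ˡ : ∀ {n} c (a b : Vec ℤ n) → dot (Vec.map (c *_) a) b ≡ c * dot a b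
  dot-map-*ˡ c []      []      = sym (*-zeroʳ c)
  dot-map-*ˡ c (x ∷ a) (y ∷ b) rewrite dot-map-*ˡ c a b = factor c x y (dot a b)
    where
    factor : ∀ c x y D → c * x * y + c * D ≡ c * (x * y + D)
    factor = solve-∀

  dot-monomials-coefficients : ∀ {v l} (y : Vec ℤ v) (p : Hom v l) → dot (monomials l y) (coefficients p) ≡ eval p y
  dot-monomials-coefficients {l = zero}      _        c         = trans (+-identityʳ (1ℤ * c)) (*-identityˡ c)
  dot-monomials-coefficients {zero}  {suc l} []       _         = refl
  dot-monomials-coefficients {suc v} {suc l} (y ∷ ys) (p₁ , p₂)
    rewrite dot-++ (Vec.map (y *_) (monomials l (y ∷ ys))) (coefficients p₁) (monomials (suc l) ys) (coefficients p₂)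
          | dot-map-*ˡ y (monomials l (y ∷ ys)) (coefficients p₁)
          | dot-monomials-coefficients (y ∷ ys) p₁ | dot-monomials-coefficients ys p₂ = refl


module SkewBollobás where

  open import Data.Nat as ℕ using (ℕ; zero; suc; z≤n; s≤s)
  open import Data.Nat.Combinatorics using (_C_)
  open import Data.Integer using (ℤ; 0ℤ; 1ℤ; _+_; _-_; -_; _*_)
  open import Data.Integer.Properties using (+-assoc; *-zeroʳ; *-zeroˡ; +-inverseʳ; i-j≡0⇒i≡j)
  open import Data.Integer.Tactic.RingSolver using (solve-∀)
  open import Data.Vec using (Vec; []; _∷_; replicate)
  open import Data.List using (List; []; _∷_; length; map)
  open import Data.List.Properties using (length-map; map-∘; map-cong)
  open import Data.List.Relation.Unary.All as All using (All; []; _∷_)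
  import Data.List.Relation.Unary.All.Properties as All
  open import Data.List.Relation.Unary.Any using (Any; here; there)
  open import Data.List.Membership.Propositional using (_∈_; find; lose)
  open import Data.List.Membership.Propositional.Properties using (∈-map⁺)
  open import Data.Product using (_×_; _,_; proj₁; proj₂)
  open import Relation.Nullary using (¬_)
  open import Relation.Binary.PropositionalEquality
  open LinearAlgebra
  open HomogeneousPolynomials

  addToHead : ∀ {n} → ℤ → Vec ℤ (suc n) → Vec ℤ (suc n)
  addToHead y (z ∷ zs) = y + z ∷ zs

  horner-addToHead : ∀ {n} y (zs : Vec ℤ (suc n)) a → horner (addToHead y zs) a ≡ y + horner zs a
  horner-addToHead y (z ∷ zs) a = +-assoc y z (a * horner zs a)

  mulRoot : ∀ {n} → ℤ → Vec ℤ n → Vec ℤ (suc n)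
  mulRoot b []       = 0ℤ ∷ []
  mulRoot b (y ∷ ys) = - (b * y) ∷ addToHead y (mulRoot b ys)

  horner-mulRoot : ∀ {n} b (ys : Vec ℤ n) a → horner (mulRoot b ys) a ≡ (a - b) * horner ys a
  horner-mulRoot b []       a = vanish a b
    where
    vanish : ∀ a b → 0ℤ + a * 0ℤ ≡ (a - b) * 0ℤ
    vanish = solve-∀
  horner-mulRoot b (y ∷ ys) a
    rewrite horner-addToHead y (mulRoot b ys) a | horner-mulRoot b ys a = factor a b y (horner ys a)
    where
    factor : ∀ a b y H → - (b * y) + a * (y + (a - b) * H) ≡ (a - b) * (y + a * H)
    factor = solve-∀

  rootCoefficients : (bs : List ℤ) → Vec ℤ (suc (length bs))
  rootCoefficients []       = 1ℤ ∷ []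
  rootCoefficients (b ∷ bs) = mulRoot b (rootCoefficients bs)

  horner-rootCoefficients : ∀ bs a → horner (rootCoefficients bs) a ≡ ∏ (map (λ b → a - b) bs)
  horner-rootCoefficients []       a = cong (1ℤ +_) (*-zeroʳ a)
  horner-rootCoefficients (b ∷ bs) a
    rewrite horner-mulRoot b (rootCoefficients bs) a | horner-rootCoefficients bs a = refl

  padZeros : ∀ {m n} → m ℕ.≤ n → Vec ℤ m → Vec ℤ n
  padZeros {n = n} z≤n      []       = replicate n 0ℤ
  padZeros         (s≤s le) (y ∷ ys) = y ∷ padZeros le ys

  horner-replicate-0 : ∀ n a → horner (replicate n 0ℤ) a ≡ 0ℤ
  horner-replicate-0 zero    a = refl
  horner-replicate-0 (suc n) a rewrite horner-replicate-0 n a = cong (0ℤ +_) (*-zeroʳ a)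

  horner-padZeros : ∀ {m n} (le : m ℕ.≤ n) (ys : Vec ℤ m) a → horner (padZeros le ys) a ≡ horner ys a
  horner-padZeros {n = n} z≤n      []       a = horner-replicate-0 n a
  horner-padZeros         (s≤s le) (y ∷ ys) a rewrite horner-padZeros le ys a = refl

  ∏-zero : ∀ {xs} → 0ℤ ∈ xs → ∏ xs ≡ 0ℤ
  ∏-zero {xs = _ ∷ xs} (here refl) = *-zeroˡ (∏ xs)
  ∏-zero {xs = x ∷ _}  (there 0∈)  = trans (cong (x *_) (∏-zero 0∈)) (*-zeroʳ x)

  ∏-nonzero : ∀ {xs} → All (_≢ 0ℤ) xs → ∏ xs ≢ 0ℤ
  ∏-nonzero []           = λ ()
  ∏-nonzero (x≢0 ∷ xs≢0) = i≢0∧j≢0⇒i*j≢0 x≢0 (∏-nonzero xs≢0)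

  module _ {A : Set} where

    Meets : List A → List A → Set
    Meets xs ys = Any (_∈ ys) xs

    data Skew : List (List A × List A) → Set where
      []   : Skew []
      cons : ∀ {X Y P} → ¬ Meets X Y → All (λ q → Meets (proj₁ q) Y) P → Skew P → Skew ((X , Y) ∷ P)

    Sized : ℕ → ℕ → List A × List A → Set
    Sized k l (X , Y) = length X ≡ l × length Y ℕ.≤ k

    -- Injectivity up to double negation: enough for the disjointness argument, and all that a
    -- labelling of a type without decidable equality can provide.
    Distinguishes : (A → ℤ) → List A → List A → Set
    Distinguishes t X Y = ∀ {x y} → x ∈ X → y ∈ Y → t x ≡ t y → ¬ ¬ x ≡ y

  module Labelling {A : Set} (t : A → ℤ) where

    resultant : List A → List A → ℤ
    resultant X Y = ∏ (map (λ x → ∏ (map (λ y → t x - t y) Y)) X)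

    resultant-zero : ∀ {X Y} → Meets X Y → resultant X Y ≡ 0ℤ
    resultant-zero {X} {Y} meets with x , x∈X , x∈Y ← find meets =
      ∏-zero (subst (_∈ map row X) row-x≡0 (∈-map⁺ row x∈X))
      where
      row : A → ℤ
      row x = ∏ (map (λ y → t x - t y) Y)
      row-x≡0 : row x ≡ 0ℤ
      row-x≡0 = ∏-zero (subst (_∈ map (λ y → t x - t y) Y) (+-inverseʳ (t x)) (∈-map⁺ (λ y → t x - t y) x∈Y))

    resultant-nonzero : ∀ {X Y} → ¬ Meets X Y → Distinguishes t X Y → resultant X Y ≢ 0ℤ
    resultant-nonzero {X} {Y} disjoint distinguishes =
      ∏-nonzero (All.map⁺ (All.tabulate λ x∈X → ∏-nonzero (All.map⁺ (All.tabulate λ y∈Y → apart x∈X y∈Y))))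
      where
      apart : ∀ {x y} → x ∈ X → y ∈ Y → t x - t y ≢ 0ℤ
      apart {x} x∈X y∈Y tx-ty≡0 =
        distinguishes x∈X y∈Y (i-j≡0⇒i≡j (t x) _ tx-ty≡0) (λ { refl → disjoint (lose x∈X y∈Y) })

    module _ (k l : ℕ) where

      length-labels≤ : ∀ Y → length Y ℕ.≤ k → length (map t Y) ℕ.≤ k
      length-labels≤ Y = subst (ℕ._≤ k) (sym (length-map t Y))

      length-labels≡ : ∀ X → length X ≡ l → length (map t X) ≡ l
      length-labels≡ X = trans (length-map t X)

      rootVector : (Y : List A) → length Y ℕ.≤ k → Vec ℤ (suc k)
      rootVector Y |Y|≤k = padZeros (s≤s (length-labels≤ Y |Y|≤k)) (rootCoefficients (map t Y))

      horner-rootVector : ∀ Y |Y|≤k x → horner (rootVector Y |Y|≤k) (t x) ≡ ∏ (map (λ y → t x - t y) Y)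
      horner-rootVector Y |Y|≤k x = begin
        horner (rootVector Y |Y|≤k) (t x)          ≡⟨ horner-padZeros (s≤s (length-labels≤ Y |Y|≤k)) (rootCoefficients (map t Y)) (t x) ⟩
        horner (rootCoefficients (map t Y)) (t x)  ≡⟨ horner-rootCoefficients (map t Y) (t x) ⟩
        ∏ (map (λ b → t x - b) (map t Y))          ≡⟨ cong ∏ (sym (map-∘ Y)) ⟩
        ∏ (map (λ y → t x - t y) Y)                ∎
        where open ≡-Reasoning

      rootMoments : (Y : List A) → length Y ℕ.≤ k → Vec ℤ (dim (suc k) l)
      rootMoments Y |Y|≤k = monomials l (rootVector Y |Y|≤k)

      powerProduct : (X : List A) → length X ≡ l → Hom (suc k) l
      powerProduct X |X|≡l = productForm (suc k) (map t X) (length-labels≡ X |X|≡l)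

      dot-rootMoments-powerProduct : ∀ X Y |X|≡l |Y|≤k →
        dot (rootMoments Y |Y|≤k) (coefficients (powerProduct X |X|≡l)) ≡ resultant X Y
      dot-rootMoments-powerProduct X Y |X|≡l |Y|≤k = begin
        dot (monomials l y) (coefficients (powerProduct X |X|≡l))  ≡⟨ dot-monomials-coefficients y (powerProduct X |X|≡l) ⟩
        eval (powerProduct X |X|≡l) y                              ≡⟨ eval-productForm (suc k) (map t X) (length-labels≡ X |X|≡l) y ⟩
        ∏ (map (horner y) (map t X))                               ≡⟨ cong ∏ (sym (map-∘ X)) ⟩
        ∏ (map (λ x → horner y (t x)) X)                           ≡⟨ cong ∏ (map-cong (horner-rootVector Y |Y|≤k) X) ⟩
        resultant X Y                                              ∎
        where
        open ≡-Reasoning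
        y : Vec ℤ (suc k)
        y = rootVector Y |Y|≤k

      vectorPairs : (P : List (List A × List A)) → All (Sized k l) P → List (Vec ℤ (dim (suc k) l) × Vec ℤ (dim (suc k) l))
      vectorPairs []            []                        = []
      vectorPairs ((X , Y) ∷ P) ((|X|≡l , |Y|≤k) ∷ sized) =
        (rootMoments Y |Y|≤k , coefficients (powerProduct X |X|≡l)) ∷ vectorPairs P sized

      length-vectorPairs : ∀ P sized → length (vectorPairs P sized) ≡ length P
      length-vectorPairs []      []          = refl
      length-vectorPairs (_ ∷ P) (_ ∷ sized) = cong suc (length-vectorPairs P sized)

      vectorPairs-triangular : ∀ P sized → All (λ q → Distinguishes t (proj₁ q) (proj₂ q)) P → Skew P →
        Triangular (vectorPairs P sized)
      vectorPairs-triangular []            []                        []                     []                          = []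
      vectorPairs-triangular ((X , Y) ∷ P) ((|X|≡l , |Y|≤k) ∷ sized) (distinct ∷ distincts) (cons disjoint later skew) =
        cons diagonal (meets⇒orthogonal P sized later) (vectorPairs-triangular P sized distincts skew)
        where
        diagonal : dot (rootMoments Y |Y|≤k) (coefficients (powerProduct X |X|≡l)) ≢ 0ℤ
        diagonal rewrite dot-rootMoments-powerProduct X Y |X|≡l |Y|≤k = resultant-nonzero disjoint distinct
        meets⇒orthogonal : ∀ Q sized′ → All (λ q → Meets (proj₁ q) Y) Q →
          All (OrthogonalTo (rootMoments Y |Y|≤k)) (vectorPairs Q sized′)
        meets⇒orthogonal []              []                      []               = []
        meets⇒orthogonal ((X′ , _) ∷ Q) ((|X′|≡l , _) ∷ sized′) (meets ∷ meetss) =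
          trans (dot-rootMoments-powerProduct X′ Y |X′|≡l |Y|≤k) (resultant-zero meets) ∷ meets⇒orthogonal Q sized′ meetss

      skew-bollobás : ∀ P → All (Sized k l) P → All (λ q → Distinguishes t (proj₁ q) (proj₂ q)) P → Skew P →
        length P ℕ.≤ (k ℕ.+ l) C l
      skew-bollobás P sized distincts skew =
        subst₂ ℕ._≤_ (length-vectorPairs P sized) (dim≡C k l)
          (triangular-length≤dim (vectorPairs P sized) (vectorPairs-triangular P sized distincts skew))

module UniformMetric (𝕄 : UniformMetricSpace) where

  open import Data.Nat using (ℕ; suc; _+_; _≤_; z≤n; _≟_)
  open import Data.Nat.Properties using (≤-reflexive; +-mono-≤; suc-injective; m+n≡0⇒m≡0; m+n≡0⇒n≡0)
  open import Data.Nat.Combinatorics using (_C_)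
  open import Data.Integer using (ℤ; +_)
  open import Data.Integer.Properties using (+-injective)
  open import Data.Vec as Vec using (Vec; []; _∷_; toList; zipWith)
  open import Data.List using (List; []; _∷_; length; map; concat; _++_)
  open import Data.List.Relation.Unary.All as All using (All)
  open import Data.List.Relation.Unary.Any using (Any; here; there)
  open import Data.List.Membership.Propositional using (_∈_)
  open import Data.List.Membership.Propositional.Properties using (∈-map⁺; ∈-concat⁺′; ∈-++⁺ˡ; ∈-++⁺ʳ)
  open import Data.Product using (_×_; proj₁; proj₂)
  open import Relation.Nullary using (¬_; Dec; yes; no; contradiction)
  open import Relation.Nullary.Decidable using (decidable-stable)
  open import Relation.Binary.Bundles using (DecSetoid)
  open import Relation.Binary.PropositionalEquality
  open SkewBollobás

  open UniformMetricSpace 𝕄 renaming (Carrier to M)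

  -- M need not have decidable equality; being at distance 0 is its decidable substitute.
  _≈_ : M → M → Set
  x ≈ y = d x y ≡ 0

  _≈?_ : ∀ x y → Dec (x ≈ y)
  x ≈? y = d x y ≟ 0

  ≡⇒≈ : ∀ {x y} → x ≡ y → x ≈ y
  ≡⇒≈ {x} refl = d-refl x

  ≈⇒¬¬≡ : ∀ {x y} → x ≈ y → ¬ ¬ x ≡ y
  ≈⇒¬¬≡ {x} {y} x≈y x≢y with trans (sym (d-uniform x y x≢y)) x≈y
  ... | ()

  ¬¬≡⇒≈ : ∀ {x y} → ¬ ¬ x ≡ y → x ≈ y
  ¬¬≡⇒≈ {x} {y} ¬¬x≡y = decidable-stable (x ≈? y) (λ x≉y → ¬¬x≡y (λ x≡y → x≉y (≡⇒≈ x≡y)))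

  ≈-refl : ∀ {x} → x ≈ x
  ≈-refl {x} = d-refl x

  ≈-sym : ∀ {x y} → x ≈ y → y ≈ x
  ≈-sym x≈y = ¬¬≡⇒≈ λ y≢x → ≈⇒¬¬≡ x≈y λ x≡y → y≢x (sym x≡y)

  ≈-trans : ∀ {x y z} → x ≈ y → y ≈ z → x ≈ z
  ≈-trans x≈y y≈z = ¬¬≡⇒≈ λ x≢z → ≈⇒¬¬≡ x≈y λ x≡y → ≈⇒¬¬≡ y≈z λ y≡z → x≢z (trans x≡y y≡z)

  ≈-decSetoid : DecSetoid _ _
  ≈-decSetoid = record
    { isDecEquivalence = record
      { isEquivalence = record { refl = ≈-refl ; sym = ≈-sym ; trans = ≈-trans }
      ; _≟_           = _≈?_
      }
    }

  d≤1 : ∀ x y → d x y ≤ 1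
  d≤1 x y with x ≈? y
  ... | yes x≈y = subst (_≤ 1) (sym x≈y) z≤n
  ... | no  x≉y = ≤-reflexive (d-uniform x y (λ x≡y → x≉y (≡⇒≈ x≡y)))

  position : List M → M → ℕ
  position []       x = 0
  position (u ∷ us) x with x ≈? u
  ... | yes _ = 0
  ... | no  _ = suc (position us x)

  position-injective : ∀ U {x y} → x ∈ U → y ∈ U → position U x ≡ position U y → x ≈ y
  position-injective (u ∷ us) {x} {y} x∈U y∈U eq with x ≈? u | y ≈? u
  ... | yes x≈u | yes y≈u = ≈-trans x≈u (≈-sym y≈u)
  ... | no  x≉u | no  y≉u = position-injective us (drop x∈U x≉u) (drop y∈U y≉u) (suc-injective eq)
    where
    drop : ∀ {z} → z ∈ u ∷ us → ¬ z ≈ u → z ∈ us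
    drop (here refl) z≉u = contradiction ≈-refl z≉u
    drop (there z∈)  _   = z∈
  position-injective (u ∷ us) x∈U y∈U () | yes _ | no _
  position-injective (u ∷ us) x∈U y∈U () | no _  | yes _

  skew-bollobás-uniform : ∀ k l (P : List (List M × List M)) → All (Sized k l) P → Skew P → length P ≤ (k + l) C l
  skew-bollobás-uniform k l P sized skew = Labelling.skew-bollobás label k l P sized distinguishes skew
    where
    U : List M
    U = concat (map (λ q → proj₁ q ++ proj₂ q) P)
    label : M → ℤ
    label x = + position U x
    distinguishes : All (λ q → Distinguishes label (proj₁ q) (proj₂ q)) P
    distinguishes = All.tabulate λ {q} q∈P x∈X y∈Y eq →
      ≈⇒¬¬≡ (position-injective U (∈-concat⁺′ (∈-++⁺ˡ x∈X) (∈-map⁺ _ q∈P))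
                                  (∈-concat⁺′ (∈-++⁺ʳ (proj₁ q) y∈Y) (∈-map⁺ _ q∈P)) (+-injective eq))

  distanceSum : ∀ {n} → Vec M n → Vec M n → ℕ
  distanceSum Y Y′ = Vec.foldr (λ _ → ℕ) _+_ 0 (zipWith d Y Y′)

  distanceSum≤length : ∀ {n} (Y Y′ : Vec M n) → distanceSum Y Y′ ≤ n
  distanceSum≤length []      []        = z≤n
  distanceSum≤length (x ∷ Y) (y ∷ Y′) = +-mono-≤ (d≤1 x y) (distanceSum≤length Y Y′)

  distanceSum-refl : ∀ {n} (Y : Vec M n) → distanceSum Y Y ≡ 0
  distanceSum-refl []      = refl
  distanceSum-refl (x ∷ Y) rewrite d-refl x = distanceSum-refl Y

  distanceSum≡0⇒≈ : ∀ {n} (Y Y′ : Vec M n) → distanceSum Y Y′ ≡ 0 →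
    ∀ {x} → x ∈ toList Y → Any (x ≈_) (toList Y′)
  distanceSum≡0⇒≈ (y ∷ Y) (y′ ∷ Y′) sum≡0 (here refl) = here (m+n≡0⇒m≡0 (d y y′) sum≡0)
  distanceSum≡0⇒≈ (y ∷ Y) (y′ ∷ Y′) sum≡0 (there x∈Y) =
    there (distanceSum≡0⇒≈ Y Y′ (m+n≡0⇒n≡0 (d y y′) sum≡0) x∈Y)

open import Data.Nat using (ℕ; _+_; _*_; _∸_; _≤_)
open import Data.Nat.Combinatorics using (_C_)
open import Data.List using (List; [])
open import Data.Product using (∃; _,_)

module Amortization where

  open import Data.Nat.Properties using (+-assoc; +-monoˡ-≤; +-monoʳ-≤; *-monoʳ-≤; module ≤-Reasoning)
  open import Data.Nat.Tactic.RingSolver using (solve-∀)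
  open import Relation.Binary.PropositionalEquality using (_≡_)

  amortize : ∀ K a p p′ m m′ δ e → a + p′ ≤ p + K * e → m′ + e ≤ δ + m →
    a + (p′ + K * m′) ≤ K * δ + (p + K * m)
  amortize K a p p′ m m′ δ e pay charge = begin
    a + (p′ + K * m′)    ≡⟨ +-assoc a p′ (K * m′) ⟨
    a + p′ + K * m′      ≤⟨ +-monoˡ-≤ (K * m′) pay ⟩
    p + K * e + K * m′   ≡⟨ regroup p K e m′ ⟩
    p + K * (m′ + e)     ≤⟨ +-monoʳ-≤ p (*-monoʳ-≤ K charge) ⟩
    p + K * (δ + m)      ≡⟨ distribute p K δ m ⟩
    K * δ + (p + K * m)  ∎
    where
    open ≤-Reasoning
    regroup : ∀ p K e m′ → p + K * e + K * m′ ≡ p + K * (m′ + e)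
    regroup = solve-∀
    distribute : ∀ p K δ m → p + K * (δ + m) ≡ K * δ + (p + K * m)
    distribute = solve-∀

  telescope : ∀ K {a φ φ′ δ r o} → a + φ′ ≤ K * δ + φ → r ≤ K * o + φ′ → a + r ≤ K * (δ + o) + φ
  telescope K {a} {φ} {φ′} {δ} {r} {o} step rest = begin
    a + r              ≤⟨ +-monoʳ-≤ a rest ⟩
    a + (K * o + φ′)   ≡⟨ exchange a (K * o) φ′ ⟩
    a + φ′ + K * o     ≤⟨ +-monoˡ-≤ (K * o) step ⟩
    K * δ + φ + K * o  ≡⟨ distribute K δ φ o ⟩
    K * (δ + o) + φ    ∎
    where
    open ≤-Reasoning
    exchange : ∀ a b c → a + (b + c) ≡ a + c + b
    exchange = solve-∀
    distribute : ∀ K δ φ o → K * δ + φ + K * o ≡ K * (δ + o) + φ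
    distribute = solve-∀

module HittingSetAnalysis (𝕄 : UniformMetricSpace) (k l : ℕ) (1≤k : 1 ≤ k) (1≤l : 1 ≤ l) where

  open import Data.Nat using (suc; _<_; z≤n; _≟_)
  open import Data.Nat.Properties
    using (≤-refl; ≤-reflexive; ≤-trans; _≤?_; <⇒≱; n≢0⇒n>0; m<n⇒n≢0; m≤m+n; m≤n+m; +-monoˡ-≤;
           +-identityʳ; *-identityʳ; *-suc; +-∸-assoc; module ≤-Reasoning)
  open import Data.Vec using (toList; lookup)
  open import Data.Vec.Properties using (length-toList)
  open import Data.Vec.Membership.Propositional.Properties using (∈-lookup; ∈-toList⁺)
  open import Data.List using (_∷_; _∷ʳ_; length; map; deduplicate)
  open import Data.List.Properties using (length-map; length-deduplicate)
  open import Data.List.Relation.Unary.All as All using (All; []; _∷_)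
  import Data.List.Relation.Unary.All.Properties as All
  open import Data.List.Relation.Unary.Any as Any using (Any; here; there; any?)
  import Data.List.Relation.Unary.Any.Properties as Any
  open import Data.List.Relation.Unary.AllPairs as AllPairs using ([]; _∷_)
  open import Data.List.Relation.Unary.Unique.Propositional using (Unique)
  open import Data.List.Relation.Unary.Unique.DecSetoid.Properties using (deduplicate-!)
  open import Data.List.Relation.Binary.Pointwise using ([]; _∷_)
  open import Data.List.Membership.Propositional using (_∈_; find; lose)
  open import Data.List.Membership.Propositional.Properties using (∈-map⁻)
  open import Data.Product using (_×_; proj₁; proj₂)
  open import Level using (0ℓ)
  open import Relation.Nullary using (¬_; Dec; yes; no; contradiction)
  open import Relation.Nullary.Decidable using (decidable-stable)
  open import Relation.Nullary.Negation using (¬¬-Monad; ¬¬-map)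
  open import Relation.Binary.PropositionalEquality
  open UniformMetricSpace 𝕄 renaming (Carrier to M)
  open MSSMS 𝕄 k l
  open SkewBollobás
  open UniformMetric 𝕄
  open Amortization

  c : ℕ
  c = (k + l) C l

  ratio : ℕ
  ratio = k * (c ∸ 1)

  Serves≈ : Config → Request → Set
  Serves≈ Y R = Any (λ x → Any (x ≈_) (toList Y)) (pts R)

  Covers : Config → List Request → Set
  Covers Y = All (Serves≈ Y)

  covers? : ∀ Y F → Dec (Covers Y F)
  covers? Y = All.all? λ R → any? (λ x → any? (x ≈?_) (toList Y)) (pts R)

  uncovered : Config → List Request → ℕ
  uncovered Y F with covers? Y F
  ... | yes _ = 0
  ... | no  _ = 1

  serves⇒serves≈ : ∀ {Y R} → Serves Y R → Serves≈ Y R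
  serves⇒serves≈ = Any.map (Any.map ≡⇒≈)

  covers-moveCost≡0 : ∀ {Y Y′} F → moveCost Y Y′ ≡ 0 → Covers Y F → Covers Y′ F
  covers-moveCost≡0 {Y} {Y′} F cost≡0 = All.map (Any.map moved)
    where
    moved : ∀ {x} → Any (x ≈_) (toList Y) → Any (x ≈_) (toList Y′)
    moved x≈∈Y with find x≈∈Y
    ... | z , z∈Y , x≈z with find (distanceSum≡0⇒≈ Y Y′ cost≡0 z∈Y)
    ...   | w , w∈Y′ , z≈w = lose w∈Y′ (≈-trans x≈z z≈w)

  uncovered≤1 : ∀ Y F → uncovered Y F ≤ 1
  uncovered≤1 Y F with covers? Y F
  ... | yes _ = z≤n
  ... | no  _ = ≤-refl

  uncovered-covers : ∀ Y F → Covers Y F → uncovered Y F ≡ 0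
  uncovered-covers Y F covers with covers? Y F
  ... | yes _       = refl
  ... | no  ¬covers = contradiction covers ¬covers

  uncovered≡0⇒covers : ∀ Y F → uncovered Y F ≡ 0 → Covers Y F
  uncovered≡0⇒covers Y F eq with covers? Y F
  ... | yes covers = covers
  uncovered≡0⇒covers Y F () | no _

  uncovered-moveCost : ∀ Y Y′ F → uncovered Y′ F ≤ moveCost Y Y′ + uncovered Y F
  uncovered-moveCost Y Y′ F with covers? Y′ F | moveCost Y Y′ ≟ 0 | covers? Y F
  ... | yes _        | _          | _          = z≤n
  ... | no  _        | no  cost≢0 | _          = ≤-trans (n≢0⇒n>0 cost≢0) (m≤m+n _ _)
  ... | no  _        | yes _      | no  _      = m≤n+m 1 _
  ... | no  ¬covers′ | yes cost≡0 | yes covers = contradiction (covers-moveCost≡0 F cost≡0 covers) ¬covers′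

  uncovered-∷ : ∀ {Y R} F → Serves Y R → uncovered Y (R ∷ F) ≤ uncovered Y F
  uncovered-∷ {Y} {R} F serves with uncovered Y F ≟ 0
  ... | no  ≢0 = ≤-trans (uncovered≤1 Y (R ∷ F)) (n≢0⇒n>0 ≢0)
  ... | yes ≡0 = ≤-trans (≤-reflexive (uncovered-covers Y (R ∷ F) covers)) z≤n
    where
    covers : Covers Y (R ∷ F)
    covers = serves⇒serves≈ {Y} {R} serves ∷ uncovered≡0⇒covers Y F ≡0

  dedup : List M → List M
  dedup = deduplicate _≈?_

  dedup-unique : ∀ xs → Unique (dedup xs)
  dedup-unique xs = AllPairs.map (λ x≉y x≡y → x≉y (≡⇒≈ x≡y)) (deduplicate-! ≈-decSetoid xs)

  serves≈⇒¬¬intersects-dedup : ∀ Y R → Serves≈ Y R → ¬ ¬ Intersects (pts R) (dedup (toList Y))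
  serves≈⇒¬¬intersects-dedup Y R served with find served
  ... | x , x∈R , x≈∈Y with find (Any.deduplicate⁺ _≈?_ (λ y≈z x≈y → ≈-trans x≈y (≈-sym y≈z)) x≈∈Y)
  ...   | w , w∈D , x≈w = ¬¬-map (λ { refl → lose x∈R w∈D }) (≈⇒¬¬≡ x≈w)

  covers⇒¬¬hittingSet : ∀ Y F → Covers Y F → ¬ ¬ HittingSet F (dedup (toList Y))
  covers⇒¬¬hittingSet Y F covers =
    ¬¬-map (dedup-unique (toList Y) ,_) (All.mapM 0ℓ ¬¬-Monad (λ {R} → serves≈⇒¬¬intersects-dedup Y R) covers)

  covers⇒minHittingSet≤k : ∀ Y F H → MinHittingSet F H → Covers Y F → length H ≤ k
  covers⇒minHittingSet≤k Y F H (_ , minimal) covers =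
    decidable-stable (length H ≤? k) (¬¬-map (λ hs → ≤-trans (minimal _ hs) dedup≤k) (covers⇒¬¬hittingSet Y F covers))
    where
    dedup≤k : length (dedup (toList Y)) ≤ k
    dedup≤k = ≤-trans (length-deduplicate _≈?_ (toList Y)) (≤-reflexive (length-toList Y))

  offline-pays-for-new-phase : ∀ {R F H} Y Y′ → MinHittingSet (R ∷ F) H → k < length H → Serves Y′ R →
    1 ≤ moveCost Y Y′ + uncovered Y F
  offline-pays-for-new-phase {R} {F} {H} Y Y′ min k<H serves with moveCost Y Y′ ≟ 0 | uncovered Y F ≟ 0
  ... | no  cost≢0 | _      = ≤-trans (n≢0⇒n>0 cost≢0) (m≤m+n _ _)
  ... | yes _      | no ≢0  = ≤-trans (n≢0⇒n>0 ≢0) (m≤n+m _ _)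
  ... | yes cost≡0 | yes ≡0 = contradiction (covers⇒minHittingSet≤k Y′ (R ∷ F) H min covers′) (<⇒≱ k<H)
    where
    covers′ : Covers Y′ (R ∷ F)
    covers′ = serves⇒serves≈ {Y′} {R} serves ∷ covers-moveCost≡0 F cost≡0 (uncovered≡0⇒covers Y F ≡0)

  movesOnto⇒occupied : ∀ {X H X′} → MovesOnto X H X′ → ∀ {x} → x ∈ H → x ∈ toList X′
  movesOnto⇒occupied {X′ = X′} (_ , _ , servers↦H , _) x∈H
    with i , _ , refl ← ∈-map⁻ (lookup X′) (subst (_ ∈_) (sym servers↦H) x∈H) = ∈-toList⁺ (∈-lookup i X′)

  -- pairs holds (Rᵢ, Hᵢ) for the faults Rᵢ of the current phase, newest first, where Hᵢ
  -- is the hitting set the servers occupied when Rᵢ arrived; hitter is the current one.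
  record PhaseInvariant (X : Config) (F : List Request) : Set where
    field
      pairs        : List (List M × List M)
      pairs-firsts : map proj₁ pairs ≡ map pts F
      pairs-sized  : All (Sized k l) pairs
      pairs-skew   : Skew pairs
      hitter       : List M
      hitter-size  : length hitter ≤ k
      hitter-hits  : All (λ R → Intersects (pts R) hitter) F
      hitter-held  : ∀ {x} → x ∈ hitter → x ∈ toList X

  module _ {X F} (inv : PhaseInvariant X F) {R} (fault : ¬ Serves X R) where
    open PhaseInvariant inv

    extended-skew : Skew ((pts R , hitter) ∷ pairs)
    extended-skew = cons (λ meets → fault (Any.map hitter-held meets)) earlier-meet pairs-skew
      where
      earlier-meet : All (λ q → Meets (proj₁ q) hitter) pairs
      earlier-meet = All.map⁻ (subst (All (λ A → Meets A hitter)) (sym pairs-firsts) (All.map⁺ hitter-hits))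

    faults-per-phase≤c : suc (length F) ≤ c
    faults-per-phase≤c = subst (λ n → suc n ≤ c) length-pairs
      (skew-bollobás-uniform k l ((pts R , hitter) ∷ pairs) ((size R , hitter-size) ∷ pairs-sized) extended-skew)
      where
      length-pairs : length pairs ≡ length F
      length-pairs = trans (sym (length-map proj₁ pairs)) (trans (cong length pairs-firsts) (length-map pts F))

    same-phase-invariant : ∀ {H X′} → MinHittingSet (R ∷ F) H → length H ≤ k → MovesOnto X H X′ →
      PhaseInvariant X′ (R ∷ F)
    same-phase-invariant {H} ((_ , hits) , _) H≤k moves = record
      { pairs        = (pts R , hitter) ∷ pairs
      ; pairs-firsts = cong (pts R ∷_) pairs-firsts
      ; pairs-sized  = (size R , hitter-size) ∷ pairs-sized
      ; pairs-skew   = extended-skew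
      ; hitter       = H
      ; hitter-size  = H≤k
      ; hitter-hits  = hits
      ; hitter-held  = movesOnto⇒occupied {X} moves
      }

  new-phase-invariant : ∀ {X R H X′} → MinHittingSet (R ∷ []) H → MovesOnto X H X′ → PhaseInvariant X′ (R ∷ [])
  new-phase-invariant {X} {R} {H} ((_ , hits) , minimal) moves = record
    { pairs        = (pts R , []) ∷ []
    ; pairs-firsts = refl
    ; pairs-sized  = (size R , z≤n) ∷ []
    ; pairs-skew   = cons meets-nothing [] []
    ; hitter       = H
    ; hitter-size  = ≤-trans H≤1 1≤k
    ; hitter-hits  = hits
    ; hitter-held  = movesOnto⇒occupied {X} moves
    }
    where
    meets-nothing : ∀ {xs : List M} → ¬ Meets xs []
    meets-nothing (here ())
    meets-nothing (there meets) = meets-nothing meets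
    point : ∃ λ x → x ∈ pts R
    point with pts R | size R
    ... | x ∷ _ | _   = x , here refl
    ... | []    | l≡0 = contradiction (sym l≡0) (m<n⇒n≢0 1≤l)
    H≤1 : length H ≤ 1
    H≤1 = minimal (proj₁ point ∷ []) (([] ∷ []) , (lose (proj₂ point) (here refl) ∷ []))

  Φ : List Request → Config → ℕ
  Φ F Y = k * (c ∸ length F) + ratio * uncovered Y F

  k*[c∸n]≡k+k*[c∸1+n] : ∀ {n} → suc n ≤ c → k * (c ∸ n) ≡ k + k * (c ∸ suc n)
  k*[c∸n]≡k+k*[c∸1+n] le = trans (cong (k *_) (+-∸-assoc 1 le)) (*-suc k _)

  step-amortized : ∀ {X F X′ F′ R} Y Y′ → PhaseInvariant X F → HSStep (X , F) R (X′ , F′) → Serves Y′ R →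
    moveCost X X′ + Φ F′ Y′ ≤ ratio * moveCost Y Y′ + Φ F Y
  step-amortized {X} {F} Y Y′ inv (no-fault _) _ =
    amortize ratio (moveCost X X) (k * (c ∸ length F)) (k * (c ∸ length F))
             (uncovered Y F) (uncovered Y′ F) (moveCost Y Y′) 0
      (≤-trans (≤-reflexive (cong (_+ k * (c ∸ length F)) (distanceSum-refl X))) (m≤m+n _ _))
      (subst (_≤ moveCost Y Y′ + uncovered Y F) (sym (+-identityʳ _)) (uncovered-moveCost Y Y′ F))
  step-amortized {X} {F} {X′} {R = R} Y Y′ inv (fault-same-phase fault _ _ _) serves =
    amortize ratio (moveCost X X′) (k * (c ∸ length F)) (k * (c ∸ suc (length F)))
             (uncovered Y F) (uncovered Y′ (R ∷ F)) (moveCost Y Y′) 0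
      (begin
        moveCost X X′ + k * (c ∸ suc (length F))  ≤⟨ +-monoˡ-≤ _ (distanceSum≤length X X′) ⟩
        k + k * (c ∸ suc (length F))             ≡⟨ one-fault-fewer ⟨
        k * (c ∸ length F)                       ≤⟨ m≤m+n _ _ ⟩
        k * (c ∸ length F) + ratio * 0           ∎)
      (subst (_≤ moveCost Y Y′ + uncovered Y F) (sym (+-identityʳ _))
        (≤-trans (uncovered-∷ F serves) (uncovered-moveCost Y Y′ F)))
    where
    open ≤-Reasoning
    one-fault-fewer : k * (c ∸ length F) ≡ k + k * (c ∸ suc (length F))
    one-fault-fewer = k*[c∸n]≡k+k*[c∸1+n] (faults-per-phase≤c inv {R} fault)
  step-amortized {X} {F} {X′} {R = R} Y Y′ inv (fault-new-phase fault min k<H _ _) serves =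
    amortize ratio (moveCost X X′) (k * (c ∸ length F)) ratio
             (uncovered Y F) (uncovered Y′ (R ∷ [])) (moveCost Y Y′) 1
      (begin
        moveCost X X′ + ratio                 ≤⟨ +-monoˡ-≤ ratio (distanceSum≤length X X′) ⟩
        k + ratio                             ≤⟨ +-monoˡ-≤ ratio (m≤m+n k _) ⟩
        k + k * (c ∸ suc (length F)) + ratio  ≡⟨ cong₂ _+_ one-fault-fewer (*-identityʳ ratio) ⟨
        k * (c ∸ length F) + ratio * 1        ∎)
      (begin
        uncovered Y′ (R ∷ []) + 1      ≡⟨ cong (_+ 1) (uncovered-covers Y′ (R ∷ []) (serves⇒serves≈ {Y′} {R} serves ∷ [])) ⟩
        1                              ≤⟨ offline-pays-for-new-phase Y Y′ min k<H serves ⟩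
        moveCost Y Y′ + uncovered Y F  ∎)
    where
    open ≤-Reasoning
    one-fault-fewer : k * (c ∸ length F) ≡ k + k * (c ∸ suc (length F))
    one-fault-fewer = k*[c∸n]≡k+k*[c∸1+n] (faults-per-phase≤c inv {R} fault)

  step-invariant : ∀ {X F X′ F′ R} → PhaseInvariant X F → HSStep (X , F) R (X′ , F′) → PhaseInvariant X′ F′
  step-invariant             inv (no-fault _)                          = inv
  step-invariant {R = R}     inv (fault-same-phase fault min H≤k moves) = same-phase-invariant inv {R} fault min H≤k moves
  step-invariant {X} {R = R} inv (fault-new-phase _ _ _ min moves)     = new-phase-invariant {X} {R} min moves

  initial-invariant : ∀ X → PhaseInvariant X []
  initial-invariant X = record
    { pairs = [] ; pairs-firsts = refl ; pairs-sized = [] ; pairs-skew = []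
    ; hitter = [] ; hitter-size = z≤n ; hitter-hits = [] ; hitter-held = λ () }

  module _ {A : List Request → HSState} (step : ∀ h R → HSStep (A h) R (A (h ∷ʳ R))) where

    run-amortized : ∀ ρ h Y Ys → PhaseInvariant (proj₁ (A h)) (proj₂ (A h)) → Feasible ρ Ys →
      pathCost (proj₁ (A h)) (runConfigs A h ρ) ≤ ratio * pathCost Y Ys + Φ (proj₂ (A h)) Y
    run-amortized []      h Y []        inv []                   = z≤n
    run-amortized (R ∷ ρ) h Y (Y′ ∷ Ys) inv (serves ∷ feasible) =
      telescope ratio (step-amortized Y Y′ inv (step h R) serves)
        (run-amortized ρ (h ∷ʳ R) Y′ Ys (step-invariant inv (step h R)) feasible)

  competitive : ∀ X₀ A → IsHS X₀ A → ∀ ρ Ys → Feasible ρ Ys →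
    algCost A X₀ ρ ≤ ratio * pathCost X₀ Ys + Φ [] X₀
  competitive X₀ A isHS ρ Ys feasible =
    subst (λ s → pathCost (proj₁ s) (runConfigs A [] ρ) ≤ ratio * pathCost X₀ Ys + Φ (proj₂ s) X₀) start
      (run-amortized step ρ [] X₀ Ys start-invariant feasible)
    where
    open IsHS isHS
    start-invariant : PhaseInvariant (proj₁ (A [])) (proj₂ (A []))
    start-invariant = subst (λ s → PhaseInvariant (proj₁ s) (proj₂ s)) (sym start) (initial-invariant X₀)

mainTheorem1 : (k l : ℕ) → 1 ≤ k → 1 ≤ l → (𝕄 : UniformMetricSpace) →
    let open MSSMS 𝕄 k l in
    (X₀ : Config) (A : List Request → HSState) → IsHS X₀ A →
    ∃ λ (α : ℕ) → (ρ : List Request) (Ys : List Config) → Feasible ρ Ys →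
      algCost A X₀ ρ ≤ (k * ((k + l) C l ∸ 1)) * pathCost X₀ Ys + α
mainTheorem1 k l 1≤k 1≤l 𝕄 X₀ A isHS = Φ [] X₀ , competitive X₀ A isHS
  where open HittingSetAnalysis 𝕄 k l 1≤k 1≤l
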